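{- Consider online preemptive scheduling of weighted intervals on D-benevolent instances: each interval $J$ has arrival time $r(J)\ge 0$, length $p(J)>0$, tight deadline $d(J)=r(J)+p(J)$, and weight $w(J)=f(p(J))$ where $f(0)=0$, $f(p)>0$ for $p>0$, and $f$ is decreasing on $(0,\infty)$. Let $RAN$-$D$ be the following randomized algorithm consisting of two deterministic algorithms $A$ and $B$, one of which is chosen with probability $1/2$ each at the start and followed thereafter (both are simulated to determine slots). Time is divided into phases and slots; slot $s_i$ starts where $s_{i-1}$ ends and has a provisional ending time $e_i$ which can only decrease. In an odd slot, $A$ maintains a "main interval" $I_M$ and $B$ a "residual interval" $I_R$; in even slots the roles of $A$ and $B$ are exchanged. At the start of slot $s_i$, the main-interval algorithm is idle and the other algorithm continues the residual interval $I_R$ (the main interval of the previous slot), and $e_i:=d(I_R)$; in the first slot of a phase there is no residual interval and $e_i$ is set to the deadline of the first arriving interval. When an interval $I$ arrives during $s_i$ (simultaneous arrivals processed in any order; an idle algorithm is treated as holding an interval of weight $0$): (1) if $d(I)\ge e_i$ and $w(I)>w(I_M)$, $I$ preempts $I_M$ and becomes the new $I_M$, and $e_i$ is unchanged; (2) if $d(I)<e_i$, $I$ preempts both $I_M$ and $I_R$, becomes the new $I_M$ and the new $I_R$ (both algorithms run $I$), and $e_i:=d(I)$; (3) otherwise $I$ is discarded. When time $e_i$ is reached, slot $s_i$ ends; if $d(I_M)>e_i$, a new slot $s_{i+1}$ begins in which $I_M$ becomes the residual interval, and otherwise the phase ends and the next phase begins at the next arrival. Then $RAN$-$D$ is $2$-competitive: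 for every D-benevolent instance, its expected value is at least half the value of an optimal offline schedule.
   Context: Online interval scheduling with preemption: intervals are revealed at their arrival times; at any moment at most one interval is processed; an interval is completed only if it is started at its arrival time and processed without interruption until its deadline; the algorithm may abort the interval it is currently processing (it is then lost). The value of a schedule is the total weight of completed intervals. The optimal offline schedule knows all intervals in advance and maximizes value over sets of pairwise non-overlapping intervals.
   Formalization: The arrival times $r(J)$ and lengths $p(J)$ are rational rather than real, and the weight function $f$ is defined on the rationals and takes rational values. -}

module Defs where

open import Data.Bool using (Bool; true; false; not; if_then_else_)
open import Data.Maybe using (Maybe; just; nothing)
open import Data.Nat using (ℕ; zero; suc) renaming (_+_ to _+ℕ_; _*_ to _*ℕ_)
open import Data.Product using (_×_)
open import Data.Sum using (_⊎_)
open import Data.List using (List; []; _∷_; length; foldl)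
open import Data.List.Relation.Unary.All using (All)
open import Data.List.Relation.Unary.AllPairs using (AllPairs)
open import Data.List.Relation.Unary.Linked using (Linked)
open import Data.Rational using (ℚ; 0ℚ; ½; _+_; _*_; _≤_; _<_)
open import Data.Rational.Properties using (_≤?_; _<?_)
open import Relation.Nullary using (yes; no)
open import Relation.Binary.PropositionalEquality using (_≡_)

-- Intervals (times in ℚ).  J = [r J , d J) with d J = r J + p J.

record Job : Set where
  constructor job
  field
    r : ℚ
    p : ℚ
open Job public

d : Job → ℚ
d J = r J + p J

Valid : Job → Set
Valid J = (0ℚ ≤ r J) × (0ℚ < p J)

wt : (ℚ → ℚ) → Maybe Job → ℚ
wt f nothing  = 0ℚ
wt f (just J) = f (p J)

DBenevolent : (ℚ → ℚ) → Set
DBenevolent f =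
  (f 0ℚ ≡ 0ℚ)
  × (∀ x → 0ℚ < x → 0ℚ < f x)
  × (∀ x y → 0ℚ < x → x ≤ y → f y ≤ f x)

Disjoint : Job → Job → Set
Disjoint a b = (d a ≤ r b) ⊎ (d b ≤ r a)

Feasible : List Job → Set
Feasible = AllPairs Disjoint

value : (ℚ → ℚ) → List Job → ℚ
value f []       = 0ℚ
value f (J ∷ Js) = f (p J) + value f Js

-- Input convention: the instance is listed by nondecreasing arrival time;
-- simultaneous arrivals are processed in list order.
SortedByArrival : List Job → Set
SortedByArrival = Linked (λ a b → r a ≤ r b)

record Active : Set where
  constructor act
  field
    aMain : Bool        -- true: A holds the main interval (B the residual);
                        -- false: roles exchanged
    e     : ℚ
    mainJ : Maybe Job   -- I_M  (nothing = idle)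
    resJ  : Maybe Job   -- I_R  (nothing = none)
open Active public

record Sim : Set where
  constructor sim
  field
    phase : Maybe Active   -- nothing = between phases
    valA  : ℚ
    valB  : ℚ
open Sim public

credit : Bool → ℚ → Sim → Sim
credit true  x (sim ph a b) = sim ph (a + x) b
credit false x (sim ph a b) = sim ph a (b + x)

endSlot : (ℚ → ℚ) → Active → ℚ → ℚ → Sim
endSlot f (act am ee mj rj) a b with credit (not am) (wt f rj) (sim nothing a b)
... | s with mj
...   | nothing = s
...   | just J with ee <? d J
...     | yes _ = sim (just (act (not am) (d J) nothing (just J))) (valA s) (valB s)
...     | no  _ = credit am (f (p J)) s

advance : (ℚ → ℚ) → ℕ → ℚ → Sim → Sim
advance f zero    t s = s
advance f (suc n) t (sim nothing a b) = sim nothing a b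
advance f (suc n) t (sim (just ac) a b) with e ac ≤? t
... | yes _ = advance f n t (endSlot f ac a b)
... | no  _ = sim (just ac) a b

flush : (ℚ → ℚ) → ℕ → Sim → Sim
flush f zero    s = s
flush f (suc n) (sim nothing a b) = sim nothing a b
flush f (suc n) (sim (just ac) a b) = flush f n (endSlot f ac a b)

rules : (ℚ → ℚ) → Job → Active → Active
rules f I (act am ee mj rj) with d I <? ee
... | yes _ = act am (d I) (just I) (just I)
... | no  _ with wt f mj <? f (p I)
...   | yes _ = act am ee (just I) rj
...   | no  _ = act am ee mj rj

-- Arrival of I (after all slot ends at times ≤ r I have been processed).
-- With no active phase, a new phase starts: first slot, A main,
-- no residual, e := d I.
arrive : (ℚ → ℚ) → Job → Sim → Sim
arrive f I (sim nothing a b)   = sim (just (rules f I (act true (d I) nothing nothing))) a b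
arrive f I (sim (just ac) a b) = sim (just (rules f I ac)) a b

-- Fuel: more than enough slot ends (every slot end either ends the phase or
-- starts a slot whose residual was a main interval; at most 2 per gap).
fuel : List Job → ℕ
fuel js = 2 +ℕ 2 *ℕ length js

step : (ℚ → ℚ) → ℕ → Sim → Job → Sim
step f n s I = arrive f I (advance f n (r I) s)

runRAND : (ℚ → ℚ) → List Job → Sim
runRAND f js = flush f (fuel js) (foldl (step f (fuel js)) (sim nothing 0ℚ 0ℚ) js)

expectedValue : (ℚ → ℚ) → List Job → ℚ
expectedValue f js = ½ * valA (runRAND f js) + ½ * valB (runRAND f js)

{-# OPTIONS --safe #-}
-- Let G be the value completed by A and B together and opt the weight of the
-- offline intervals that have arrived so far.  During a slot with ending time e
-- we maintain: I_M and I_R have arrived and have deadline at least e, and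
-- either opt ≤ G + w(I_R), or opt ≤ G + w(I_R) + w(I_M) and no later offline
-- interval starts before e.  An offline interval arriving in the slot either
-- ends before e (rule (2) then runs it in both algorithms), or it is dominated
-- by the new I_M, after which the rest of the offline schedule starts after e.
-- Since f is decreasing, an interval nested in I_M or I_R weighs at least as
-- much as they do, which is what makes rule (2) safe.  At the end of the slot
-- I_R completes and I_M either completes or becomes the next residual
-- interval, so the bound is inherited; finally opt(S) ≤ val A + val B.
module Submission where

open import Defs
open import Data.List using (List)
open import Data.List.Relation.Unary.All using (All)
open import Data.List.Relation.Binary.Sublist.Propositional using (_⊆_)
open import Data.Rational using (ℚ; ½; _*_; _≤_)

open import Data.Bool using (true; false; not)
open import Data.Maybe using (Maybe; just; nothing)
open import Data.Nat using (zero; suc) renaming (_*_ to _ℕ*_)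
open import Data.Product using (_×_; _,_; proj₁; proj₂)
open import Data.Sum using (inj₁; inj₂)
open import Data.Unit using (⊤; tt)
open import Data.Empty using (⊥-elim)
open import Data.List using ([]; _∷_; foldl; length)
open import Data.List.Relation.Unary.All using ([]; _∷_)
import Data.List.Relation.Unary.All as All
open import Data.List.Relation.Unary.AllPairs using (AllPairs; []; _∷_)
open import Data.List.Relation.Unary.Linked.Properties using (Linked⇒AllPairs)
open import Data.List.Relation.Binary.Sublist.Heterogeneous.Core using ([]; _∷ʳ_; _∷_)
open import Data.List.Relation.Binary.Sublist.Propositional.Properties using (All-resp-⊆)
open import Data.Rational using (0ℚ; _+_; _<_)
open import Data.Rational.Properties
  using (≤-refl; ≤-trans; ≤-reflexive; <⇒≤; ≮⇒≥; <-irrefl; <-≤-trans;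
         +-identityʳ; +-identityˡ; +-assoc; +-comm; +-mono-≤; +-monoˡ-≤; +-monoʳ-≤;
         +-monoʳ-<; +-mono-≤-<; _<?_; _≤?_; ≰⇒>; *-distribˡ-+; *-monoˡ-≤-nonNeg;
         module ≤-Reasoning)
open import Relation.Nullary using (yes; no; ¬_)
open import Relation.Binary.PropositionalEquality
  using (_≡_; refl; sym; cong; subst; module ≡-Reasoning)

<⇒≱ : ∀ {x y} → x < y → ¬ (y ≤ x)
<⇒≱ x<y y≤x = <-irrefl refl (<-≤-trans x<y y≤x)

≤-+-nonNeg : ∀ {x y z} → x ≤ y → 0ℚ ≤ z → x ≤ y + z
≤-+-nonNeg {x} x≤y 0≤z = ≤-trans (≤-reflexive (sym (+-identityʳ x))) (+-mono-≤ x≤y 0≤z)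

r<d : ∀ {I} → Valid I → r I < d I
r<d {I} (_ , 0<p) = subst (_< d I) (+-identityʳ (r I)) (+-monoʳ-< (r I) 0<p)

nested⇒p≤ : ∀ {J I} → r J ≤ r I → d I ≤ d J → p I ≤ p J
nested⇒p≤ rJ≤rI dI≤dJ = ≮⇒≥ (λ pJ<pI → <⇒≱ (+-mono-≤-< rJ≤rI pJ<pI) dI≤dJ)

disjoint-later⇒after : ∀ {I K} → Valid K → r I ≤ r K → Disjoint I K → d I ≤ r K
disjoint-later⇒after _ _ (inj₁ dI≤rK) = dI≤rK
disjoint-later⇒after vK rI≤rK (inj₂ dK≤rI) = ⊥-elim (<⇒≱ (r<d vK) (≤-trans dK≤rI rI≤rK))

disjoint-later⇒after-all : ∀ {I S} → All Valid S → All (λ K → r I ≤ r K) S →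
  All (Disjoint I) S → All (λ K → d I ≤ r K) S
disjoint-later⇒after-all []         []             []           = []
disjoint-later⇒after-all (vK ∷ vs) (rI≤rK ∷ later) (dK ∷ disj) =
  disjoint-later⇒after vK rI≤rK dK ∷ disjoint-later⇒after-all vs later disj

total : Sim → ℚ
total s = valA s + valB s

phase-credit : ∀ am x s → phase (credit am x s) ≡ phase s
phase-credit true  x s = refl
phase-credit false x s = refl

total-credit : ∀ am x s → total (credit am x s) ≡ total s + x
total-credit true  x s = begin
  (valA s + x) + valB s ≡⟨ +-assoc (valA s) x (valB s) ⟩
  valA s + (x + valB s) ≡⟨ cong (valA s +_) (+-comm x (valB s)) ⟩
  valA s + (valB s + x) ≡⟨ sym (+-assoc (valA s) (valB s) x) ⟩
  total s + x           ∎
  where open ≡-Reasoning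
total-credit false x s = sym (+-assoc (valA s) (valB s) x)

module SlotEnds (f : ℚ → ℚ) where

  EndsAfter : ℚ → Maybe Active → Set
  EndsAfter t nothing   = ⊤
  EndsAfter t (just ac) = t < e ac

  -- A slot end leaves the main interval idle, so a second one ends the phase:
  -- two slot ends between consecutive arrivals always suffice.
  MainIdle : Maybe Active → Set
  MainIdle nothing   = ⊤
  MainIdle (just ac) = mainJ ac ≡ nothing

  endSlot-mainIdle : ∀ ac a b → MainIdle (phase (endSlot f ac a b))
  endSlot-mainIdle (act am ee nothing rj) a b
    rewrite phase-credit (not am) (wt f rj) (sim nothing a b) = tt
  endSlot-mainIdle (act am ee (just J) rj) a b with ee <? d J
  ... | yes _ = refl
  ... | no  _ rewrite phase-credit am (f (p J)) (credit (not am) (wt f rj) (sim nothing a b))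
                    | phase-credit (not am) (wt f rj) (sim nothing a b) = tt

  advance-finished : ∀ n t s → phase s ≡ nothing → EndsAfter t (phase (advance f n t s))
  advance-finished zero    t s                  idle rewrite idle = tt
  advance-finished (suc n) t (sim .nothing a b) refl = tt

  advance-mainIdle : ∀ n t s → MainIdle (phase s) → EndsAfter t (phase (advance f (suc n) t s))
  advance-mainIdle n t (sim nothing a b) _ = tt
  advance-mainIdle n t (sim (just (act am ee .nothing rj)) a b) refl with ee ≤? t
  ... | yes _   = advance-finished n t _ (phase-credit (not am) (wt f rj) (sim nothing a b))
  ... | no ee≰t = ≰⇒> ee≰t

  advance-complete : ∀ n t s → EndsAfter t (phase (advance f (suc (suc n)) t s))
  advance-complete n t (sim nothing    a b) = tt
  advance-complete n t (sim (just ac) a b) with e ac ≤? t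
  ... | yes _   = advance-mainIdle n t _ (endSlot-mainIdle ac a b)
  ... | no ee≰t = ≰⇒> ee≰t

  flush-finished : ∀ n s → phase s ≡ nothing → flush f n s ≡ s
  flush-finished zero    s                  _    = refl
  flush-finished (suc n) (sim .nothing a b) refl = refl

module Analysis (f : ℚ → ℚ) (benevolent : DBenevolent f) where

  open SlotEnds f

  f-nonNeg : ∀ {I} → Valid I → 0ℚ ≤ f (p I)
  f-nonNeg {I} (_ , 0<p) = <⇒≤ (proj₁ (proj₂ benevolent) (p I) 0<p)

  f-nested : ∀ {J I} → Valid I → r J ≤ r I → d I ≤ d J → f (p J) ≤ f (p I)
  f-nested {J} {I} (_ , 0<p) rJ≤rI dI≤dJ =
    proj₂ (proj₂ benevolent) (p I) (p J) 0<p (nested⇒p≤ rJ≤rI dI≤dJ)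

  Alive : ℚ → ℚ → Maybe Job → Set
  Alive t e nothing  = ⊤
  Alive t e (just J) = Valid J × r J ≤ t × e ≤ d J

  alive-later : ∀ {t t' e} m → t ≤ t' → Alive t e m → Alive t' e m
  alive-later nothing  _    _              = tt
  alive-later (just J) t≤t' (vJ , rJ≤t , e≤d) = vJ , ≤-trans rJ≤t t≤t' , e≤d

  wt-nonNeg : ∀ {t e} m → Alive t e m → 0ℚ ≤ wt f m
  wt-nonNeg nothing  _        = ≤-refl
  wt-nonNeg (just J) (vJ , _) = f-nonNeg vJ

  wt≤nested : ∀ {e I} m → Alive (r I) e m → Valid I → d I < e → wt f m ≤ f (p I)
  wt≤nested nothing  _                    vI _    = f-nonNeg vI
  wt≤nested (just J) (_ , rJ≤rI , e≤dJ) vI dI<e =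
    f-nested vI rJ≤rI (<⇒≤ (<-≤-trans dI<e e≤dJ))

  data SlotBound (opt : ℚ) (S : List Job) (G : ℚ) (ac : Active) : Set where
    residual-covers : opt ≤ G + wt f (resJ ac) → SlotBound opt S G ac
    main-covers     : opt ≤ (G + wt f (resJ ac)) + wt f (mainJ ac) →
                      All (λ K → e ac ≤ r K) S → SlotBound opt S G ac

  record SlotInv (t opt : ℚ) (S : List Job) (G : ℚ) (ac : Active) : Set where
    constructor slotInv
    field
      mainAlive : Alive t (e ac) (mainJ ac)
      resAlive  : Alive t (e ac) (resJ ac)
      bound     : SlotBound opt S G ac

  PhaseInv : ℚ → ℚ → List Job → ℚ → Maybe Active → Set
  PhaseInv t opt S G nothing   = opt ≤ G
  PhaseInv t opt S G (just ac) = SlotInv t opt S G ac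

  -- At time t, opt is the weight of the offline intervals that have arrived
  -- and S lists those still to come.
  Accounted : ℚ → ℚ → List Job → Sim → Set
  Accounted t opt S s = PhaseInv t opt S (total s) (phase s)

  accounted-later : ∀ {t t' opt S} s → t ≤ t' → Accounted t opt S s → Accounted t' opt S s
  accounted-later (sim nothing    a b) _    h = h
  accounted-later (sim (just ac) a b) t≤t' (slotInv hm hr bd) =
    slotInv (alive-later (mainJ ac) t≤t' hm) (alive-later (resJ ac) t≤t' hr) bd

  accounted-finished : ∀ {t opt S} s → phase s ≡ nothing → Accounted t opt S s → opt ≤ total s
  accounted-finished {t} {opt} {S} s idle h = subst (PhaseInv t opt S (total s)) idle h

  accounted-credit : ∀ {t opt S} am x s →
    PhaseInv t opt S (total s + x) (phase s) → Accounted t opt S (credit am x s)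
  accounted-credit am x s h rewrite phase-credit am x s | total-credit am x s = h

  bound-with-main : ∀ {t opt S G} ac → SlotInv t opt S G ac →
    opt ≤ (G + wt f (resJ ac)) + wt f (mainJ ac)
  bound-with-main ac (slotInv hm _ (residual-covers h)) = ≤-+-nonNeg h (wt-nonNeg (mainJ ac) hm)
  bound-with-main ac (slotInv _  _ (main-covers h _))   = h

  credit-idle : ∀ {opt} am x a b {y} → opt ≤ ((a + b) + x) + y →
    opt ≤ total (credit am x (sim nothing a b)) + y
  credit-idle am x a b {y} h = subst (λ G → _ ≤ G + y) (sym (total-credit am x (sim nothing a b))) h

  endSlot-accounted : ∀ {t opt S} ac a b → SlotInv t opt S (a + b) ac →
    Accounted t opt S (endSlot f ac a b)
  endSlot-accounted (act am ee nothing rj) a b h =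
    accounted-credit (not am) (wt f rj) (sim nothing a b)
      (≤-trans (bound-with-main (act am ee nothing rj) h) (≤-reflexive (+-identityʳ _)))
  endSlot-accounted (act am ee (just J) rj) a b h@(slotInv (vJ , rJ≤t , _) _ _) with ee <? d J
  ... | yes _ = slotInv tt (vJ , rJ≤t , ≤-refl)
                  (residual-covers (credit-idle (not am) (wt f rj) a b opt≤))
    where opt≤ = bound-with-main (act am ee (just J) rj) h
  ... | no  _ = accounted-credit am (f (p J)) s
                  (subst (PhaseInv _ _ _ (total s + f (p J))) (sym idle)
                    (credit-idle (not am) (wt f rj) a b opt≤))
    where
      s = credit (not am) (wt f rj) (sim nothing a b)
      idle = phase-credit (not am) (wt f rj) (sim nothing a b)
      opt≤ = bound-with-main (act am ee (just J) rj) h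

  advance-accounted : ∀ {t opt S} n t' s → Accounted t opt S s →
    Accounted t opt S (advance f n t' s)
  advance-accounted zero    t' s                    h = h
  advance-accounted (suc n) t' (sim nothing    a b) h = h
  advance-accounted (suc n) t' (sim (just ac) a b) h with e ac ≤? t'
  ... | yes _ = advance-accounted n t' (endSlot f ac a b) (endSlot-accounted ac a b h)
  ... | no  _ = h

  rules-accounted : ∀ {opt S G} I ac → SlotInv (r I) opt S G ac → Valid I →
    SlotInv (r I) opt S G (rules f I ac)
  rules-accounted {G = G} I (act am ee mj rj) (slotInv hm hr bd) vI with d I <? ee
  ... | yes dI<e = slotInv (vI , ≤-refl , ≤-refl) (vI , ≤-refl , ≤-refl) (shrink bd)
    where
      wr≤ = wt≤nested rj hr vI dI<e
      shrink : ∀ {opt S} → SlotBound opt S G (act am ee mj rj) →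
               SlotBound opt S G (act am (d I) (just I) (just I))
      shrink (residual-covers h)    = residual-covers (≤-trans h (+-monoʳ-≤ G wr≤))
      shrink (main-covers h after) =
        main-covers (≤-trans h (+-mono-≤ (+-monoʳ-≤ G wr≤) (wt≤nested mj hm vI dI<e)))
                    (All.map (λ e≤r → <⇒≤ (<-≤-trans dI<e e≤r)) after)
  ... | no dI≮e with wt f mj <? f (p I)
  ...   | yes lighter = slotInv (vI , ≤-refl , ≮⇒≥ dI≮e) hr (heavier bd)
    where
      heavier : ∀ {opt S} → SlotBound opt S G (act am ee mj rj) →
                SlotBound opt S G (act am ee (just I) rj)
      heavier (residual-covers h)    = residual-covers h
      heavier (main-covers h after) =
        main-covers (≤-trans h (+-monoʳ-≤ (G + wt f rj) (<⇒≤ lighter))) after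
  ...   | no  _ = slotInv hm hr bd

  rules-charges : ∀ {opt S G} I ac → SlotInv (r I) opt (I ∷ S) G ac → Valid I → r I < e ac →
    All (λ K → d I ≤ r K) S → SlotInv (r I) (opt + f (p I)) S G (rules f I ac)
  rules-charges I ac (slotInv _ _ (main-covers _ (e≤rI ∷ _))) _ rI<e _ = ⊥-elim (<⇒≱ rI<e e≤rI)
  rules-charges {G = G} I (act am ee mj rj) (slotInv hm hr (residual-covers h)) vI _ after
    with d I <? ee
  ... | yes dI<e = slotInv (vI , ≤-refl , ≤-refl) (vI , ≤-refl , ≤-refl)
                     (main-covers (+-monoˡ-≤ (f (p I)) opt≤) after)
    where opt≤ = ≤-trans h (+-monoʳ-≤ G (wt≤nested rj hr vI dI<e))
  ... | no dI≮e with wt f mj <? f (p I)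
  ...   | yes _ = slotInv (vI , ≤-refl , ≮⇒≥ dI≮e) hr
                    (main-covers (+-monoˡ-≤ (f (p I)) h) (All.map (≤-trans (≮⇒≥ dI≮e)) after))
  ...   | no not-lighter = slotInv hm hr
                    (main-covers (+-mono-≤ h (≮⇒≥ not-lighter))
                                 (All.map (≤-trans (≮⇒≥ dI≮e)) after))

  fresh-slot : ∀ {t opt S G e} → opt ≤ G → SlotInv t opt S G (act true e nothing nothing)
  fresh-slot {G = G} h =
    slotInv tt tt (residual-covers (≤-trans h (≤-reflexive (sym (+-identityʳ G)))))

  arrive-accounted : ∀ {opt S} I s → Accounted (r I) opt S s → Valid I →
    Accounted (r I) opt S (arrive f I s)
  arrive-accounted I (sim nothing    a b) h vI = rules-accounted I _ (fresh-slot h) vI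
  arrive-accounted I (sim (just ac) a b) h vI = rules-accounted I ac h vI

  arrive-charges : ∀ {opt S} I s → Accounted (r I) opt (I ∷ S) s → EndsAfter (r I) (phase s) →
    Valid I → All (λ K → d I ≤ r K) S → Accounted (r I) (opt + f (p I)) S (arrive f I s)
  arrive-charges I (sim nothing    a b) h _    vI after =
    rules-charges I _ (fresh-slot h) vI (r<d vI) after
  arrive-charges I (sim (just ac) a b) h rI<e vI after = rules-charges I ac h vI rI<e after

  flush-mainIdle : ∀ {t opt S} n s → MainIdle (phase s) → Accounted t opt S s →
    opt ≤ total (flush f (suc n) s)
  flush-mainIdle n (sim nothing a b) _ h = h
  flush-mainIdle n (sim (just (act am ee .nothing rj)) a b) refl h =
    subst (λ s → _ ≤ total s) (sym (flush-finished n s′ idle))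
      (accounted-finished s′ idle (endSlot-accounted (act am ee nothing rj) a b h))
    where
      s′ = credit (not am) (wt f rj) (sim nothing a b)
      idle = phase-credit (not am) (wt f rj) (sim nothing a b)

  flush-complete : ∀ {t opt S} n s → Accounted t opt S s → opt ≤ total (flush f (suc (suc n)) s)
  flush-complete n (sim nothing    a b) h = h
  flush-complete n (sim (just ac) a b) h =
    flush-mainIdle n _ (endSlot-mainIdle ac a b) (endSlot-accounted ac a b h)

  step-accounted : ∀ {t opt S} n s I → Accounted t opt S s → Valid I → t ≤ r I →
    Accounted (r I) opt S (step f n s I)
  step-accounted n s I h vI t≤rI =
    arrive-accounted I _ (advance-accounted n (r I) s (accounted-later s t≤rI h)) vI

  step-charges : ∀ {t opt S} n s I → Accounted t opt (I ∷ S) s → Valid I → t ≤ r I →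
    All (λ K → d I ≤ r K) S → Accounted (r I) (opt + f (p I)) S (step f (suc (suc n)) s I)
  step-charges n s I h vI t≤rI after =
    arrive-charges I _ (advance-accounted (suc (suc n)) (r I) s (accounted-later s t≤rI h))
      (advance-complete n (r I) s) vI after

  run-accounted : ∀ {t opt} n js S s → S ⊆ js → All Valid js →
    AllPairs (λ a b → r a ≤ r b) js → All (λ K → t ≤ r K) js → Feasible S →
    Accounted t opt S s →
    opt + value f S ≤ total (flush f (suc (suc n)) (foldl (step f (suc (suc n))) s js))
  run-accounted n [] .[] s [] [] [] [] [] h =
    ≤-trans (≤-reflexive (+-identityʳ _)) (flush-complete n s h)
  run-accounted n (I ∷ js) S s (.I ∷ʳ sub) (vI ∷ vs) (later ∷ sorted) (t≤rI ∷ _) feasible h =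
    run-accounted n js S _ sub vs sorted later feasible (step-accounted (suc (suc n)) s I h vI t≤rI)
  run-accounted {opt = opt} n (I ∷ js) (.I ∷ S) s (refl ∷ sub) (vI ∷ vs) (later ∷ sorted)
                (t≤rI ∷ _) (disjoint ∷ feasible) h =
    ≤-trans (≤-reflexive (sym (+-assoc opt (f (p I)) (value f S))))
      (run-accounted n js S _ sub vs sorted later feasible (step-charges n s I h vI t≤rI after))
    where
      after = disjoint-later⇒after-all (All-resp-⊆ sub vs) (All-resp-⊆ sub later) disjoint

  offline≤completed : ∀ js → All Valid js → SortedByArrival js →
    ∀ S → S ⊆ js → Feasible S → value f S ≤ total (runRAND f js)
  offline≤completed js vs sorted S sub feasible =
    subst (_≤ total (runRAND f js)) (+-identityˡ (value f S))
      (run-accounted (2 ℕ* length js) js S _ sub vs (Linked⇒AllPairs ≤-trans sorted)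
                     (All.map proj₁ vs) feasible ≤-refl)

mainTheorem5 : (f : ℚ → ℚ) → DBenevolent f →
    (js : List Job) → All Valid js → SortedByArrival js →
    (S : List Job) → S ⊆ js → Feasible S →
    ½ * value f S ≤ expectedValue f js
mainTheorem5 f benevolent js vs sorted S sub feasible = begin
  ½ * value f S              ≤⟨ *-monoˡ-≤-nonNeg ½ offline≤ ⟩
  ½ * (valA R + valB R)      ≡⟨ *-distribˡ-+ ½ (valA R) (valB R) ⟩
  expectedValue f js         ∎
  where
    open ≤-Reasoning
    R = runRAND f js
    offline≤ = Analysis.offline≤completed f benevolent js vs sorted S sub feasible
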